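{- Let $k\geq 2$ and $b$ be integers with $1\leq b\leq k/2$, and let $\Delta\ge 1$. Let $G=(V,E)$ be a $\Delta$-regular graph and let $H_G$ be the hypergraph constructed from $G$ as follows: for each $v\in V$ create a set $B_v$ of $b$ new vertices (these sets pairwise disjoint); for each edge $e=\{u,v\}\in E$ create a set $C_e$ of $k-2b$ new vertices (disjoint from all other created vertices), and let the hyperedge corresponding to $e$ be $B_u\cup B_v\cup C_e$. The vertex set of $H_G$ is the union of all $B_v$ and $C_e$, and its hyperedges are the sets $B_u\cup B_v\cup C_e$ for $e=\{u,v\}\in E$. Let $\mathcal{I}(H_G)$ be the set of (weak) independent sets of $H_G$. Then \[ |\mathcal{I}(H_G)| = 2^{|E|(k-2b)}\, Z(G), \] where $Z(G)=\sum_{\sigma:V\to\{0,1\}} \lambda^{n_0(\sigma)}\beta^{m_{00}(\sigma)}\gamma^{m_{11}(\sigma)}$ with $\beta=1$, $\gamma=1-\frac{1}{2^{k-2b}}$, $\lambda=2^b-1$.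
   Context: A set $I$ of vertices of a hypergraph is a (weak) independent set if no hyperedge is entirely contained in $I$. For a configuration $\sigma:V\to\{0,1\}$, $n_0(\sigma)$ is the number of vertices $v$ with $\sigma(v)=0$, $m_{00}(\sigma)$ is the number of edges of $G$ both of whose endpoints have spin $0$, and $m_{11}(\sigma)$ is the number of edges both of whose endpoints have spin $1$. $Z(G)$ is the partition function of the 2-spin system with interaction matrix $\begin{bmatrix}\beta&1\\1&\gamma\end{bmatrix}$ and external field $(\lambda,1)$. -}

module Defs where

open import Data.Bool using (Bool; true; false)
open import Data.Nat as ℕ using (ℕ; zero; suc; _+_; _*_; _∸_; _≤_)
open import Data.Nat.Properties using (m^n≢0)
open import Data.Integer using (+_)
open import Data.Rational as ℚ using (ℚ; 0ℚ; 1ℚ; _/_)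
open import Data.Fin using (Fin; _↑ˡ_; _↑ʳ_; combine)
open import Data.Fin.Subset using (Subset; ⁅_⁆; ⋃; _⊆_)
open import Data.Fin.Subset.Properties using (_⊆?_)
open import Data.Fin.Properties using (all?)
open import Data.Vec using (Vec; []; _∷_; lookup)
open import Data.List using (List; []; _∷_; map; _++_; length; filter; foldr)
open import Data.List using () renaming (allFin to allFinL)
open import Data.Product using (_×_; _,_; proj₁; proj₂)
open import Data.Sum using (_⊎_)
open import Relation.Nullary using (¬_; ¬?; Dec; yes; no)
open import Relation.Unary using (Decidable)
open import Relation.Binary.PropositionalEquality using (_≡_; _≢_)

record Graph : Set where
  field
    n     : ℕ
    m     : ℕ
    ends  : Fin m → Fin n × Fin n
    loopless : ∀ e → proj₁ (ends e) ≢ proj₂ (ends e)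
    simple   : ∀ e f → (ends e ≡ ends f ⊎ ends e ≡ (proj₂ (ends f) , proj₁ (ends f))) → e ≡ f

open Graph public

incident : (G : Graph) → Fin (n G) → Fin (m G) → Set
incident G v e = proj₁ (ends G e) ≡ v ⊎ proj₂ (ends G e) ≡ v

incident? : (G : Graph) (v : Fin (n G)) → Decidable (incident G v)
incident? G v e with proj₁ (ends G e) Data.Fin.≟ v | proj₂ (ends G e) Data.Fin.≟ v
... | yes p | _     = yes (Data.Sum.inj₁ p)
... | no _  | yes q = yes (Data.Sum.inj₂ q)
... | no p  | no q  = no λ { (Data.Sum.inj₁ x) → p x ; (Data.Sum.inj₂ x) → q x }

degree : (G : Graph) → Fin (n G) → ℕ
degree G v = length (filter (incident? G v) (allFinL (m G)))

Regular : ℕ → Graph → Set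
Regular Δ G = ∀ v → degree G v ≡ Δ

record Hypergraph : Set where
  field
    N      : ℕ
    M      : ℕ
    hedge  : Fin M → Subset N

open Hypergraph public

IsIndependent : (H : Hypergraph) → Subset (N H) → Set
IsIndependent H I = ∀ f → ¬ (hedge H f ⊆ I)

isIndependent? : (H : Hypergraph) → Decidable (IsIndependent H)
isIndependent? H I = all? (λ f → ¬? (hedge H f ⊆? I))

allVecs : (N : ℕ) → List (Vec Bool N)
allVecs zero    = [] ∷ []
allVecs (suc N) = map (true ∷_) (allVecs N) ++ map (false ∷_) (allVecs N)

numIndep : Hypergraph → ℕ
numIndep H = length (filter (isIndependent? H) (allVecs (N H)))

-- The hypergraph H_G.  Vertices: Fin (n*b + m*c), c = k - 2b;
-- B_v = { combine v j ↑ˡ (m*c) | j : Fin b },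
-- C_e = { (n*b) ↑ʳ combine e j | j : Fin c }.

Bvert : (G : Graph) (b c : ℕ) → Fin (n G) → Fin b → Fin (n G * b + m G * c)
Bvert G b c v j = combine v j ↑ˡ (m G * c)

Cvert : (G : Graph) (b c : ℕ) → Fin (m G) → Fin c → Fin (n G * b + m G * c)
Cvert G b c e j = (n G * b) ↑ʳ combine e j

HG : (G : Graph) (k b : ℕ) → Hypergraph
HG G k b = record
  { N     = n G * b + m G * c
  ; M     = m G
  ; hedge = λ e → ⋃ ( map (λ j → ⁅ Bvert G b c (proj₁ (ends G e)) j ⁆) (allFinL b)
                   ++ map (λ j → ⁅ Bvert G b c (proj₂ (ends G e)) j ⁆) (allFinL b)
                   ++ map (λ j → ⁅ Cvert G b c e j ⁆) (allFinL c))
  }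
  where c = k ∸ 2 * b

infixr 8 _^ℚ_
_^ℚ_ : ℚ → ℕ → ℚ
x ^ℚ zero  = 1ℚ
x ^ℚ suc k = x ℚ.* (x ^ℚ k)

ℕtoℚ : ℕ → ℚ
ℕtoℚ k = + k / 1

sumℚ : List ℚ → ℚ
sumℚ = foldr ℚ._+_ 0ℚ

countF : ∀ {a} → (Fin a → Bool) → ℕ
countF {a} p = length (filter (λ i → p i Data.Bool.≟ true) (allFinL a))

-- σ(v) = false means spin 0, true means spin 1
n0 : (G : Graph) → Vec Bool (n G) → ℕ
n0 G σ = countF (λ v → Data.Bool.not (lookup σ v))

m00 : (G : Graph) → Vec Bool (n G) → ℕ
m00 G σ = countF (λ e → Data.Bool.not (lookup σ (proj₁ (ends G e)))
                 Data.Bool.∧ Data.Bool.not (lookup σ (proj₂ (ends G e))))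

m11 : (G : Graph) → Vec Bool (n G) → ℕ
m11 G σ = countF (λ e → lookup σ (proj₁ (ends G e)) Data.Bool.∧ lookup σ (proj₂ (ends G e)))

Z : (G : Graph) (λ' β γ : ℚ) → ℚ
Z G λ' β γ = sumℚ (map (λ σ → (λ' ^ℚ n0 G σ) ℚ.* (β ^ℚ m00 G σ) ℚ.* (γ ^ℚ m11 G σ))
                      (allVecs (n G)))

gammaOf : ℕ → ℚ
gammaOf c = 1ℚ ℚ.- (_/_ (+ 1) (2 ℕ.^ c) {{m^n≢0 2 c}})

-- Split an indicator vector of H_G as I = X ++ Y, with X on the blocks B_v and
-- Y on the blocks C_e.  Let σ(v) = 1 iff B_v ⊆ X.  The hyperedge of e = {u,v}
-- lies in I iff σ(u) = σ(v) = 1 and C_e ⊆ Y, so for fixed X the sum over Y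
-- factorises over the edges into 2^c − 1 (if σ(u) = σ(v) = 1) or 2^c.  Each σ
-- arises from (2^b − 1)^{n₀(σ)} vectors X, and 2^c − 1 = 2^c γ.

module Submission where

open import Defs
open import Data.Nat using (ℕ; _≤_; _*_; _∸_; _^_)
open import Data.Rational using (1ℚ)
open import Relation.Binary.PropositionalEquality using (_≡_)

open import Data.Bool using (Bool; true; false; _∧_; not; if_then_else_; T; T?; _≟_)
open import Data.Bool.Properties using (T-≡; T-∧; ∧-assoc)
open import Data.Fin using (Fin; zero; suc; combine)
open import Data.Fin.Subset using (Subset; ⁅_⁆; ⋃; _⊆_; _∈_; _∪_)
open import Data.Fin.Subset.Properties using (p⊆p∪q; q⊆p∪q; x∈p∪q⁻; ⊆-min; x∈⁅x⁆; x∈⁅y⁆⇒x≡y)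
open import Data.Integer as ℤ using ()
import Data.Integer.Properties as ℤₚ
open import Data.List as List using (List; []; _∷_; length; filter; map)
open import Data.List using () renaming (allFin to allFinL)
import Data.List.Properties as Listₚ
open import Data.List.Relation.Unary.All as All using (All; []; _∷_)
import Data.List.Relation.Unary.All.Properties as Allₚ
open import Data.Nat as ℕ using (zero; suc; _+_; _<_)
open import Data.Nat.Coprimality as Coprime using (1-coprimeTo)
open import Data.Nat.ListAction using (sum)
open import Data.Nat.ListAction.Properties using (sum-++)
import Data.Nat.Properties as ℕₚ
open import Data.Nat.Tactic.RingSolver using (solve-∀)
open import Data.Product using (_×_; _,_; proj₁; proj₂; map₂)
open import Data.Product.Function.NonDependent.Propositional using (_×-⇔_)
open import Data.Rational as ℚ using (ℚ; mkℚ; _/_)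
import Data.Rational.Properties as ℚₚ
open import Data.Rational.Solver using (module +-*-Solver)
open import Data.Sum using ([_,_])
open import Data.Unit using (tt)
open import Data.Vec using (Vec; []; _∷_; _++_; lookup; tabulate)
import Data.Vec.Properties as Vecₚ
open import Function using (_∘_; _⇔_; mk⇔; Equivalence)
import Function.Properties.Equivalence as ⇔
open import Function.Properties.Inverse using (↔⇒⇔)
open import Relation.Binary.PropositionalEquality
  using (refl; sym; trans; cong; cong₂; subst; _≗_; module ≡-Reasoning)
open import Relation.Nullary using (¬_; does)
open import Relation.Nullary.Decidable using (does-⇔)

open Equivalence using (to; from)

𝟙 : Bool → ℕ
𝟙 true  = 1
𝟙 false = 0

and : ∀ {n} → Vec Bool n → Bool
and []       = true
and (x ∷ xs) = x ∧ and xs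

∏ : ∀ {m} → (Fin m → ℕ) → ℕ
∏ {zero}  f = 1
∏ {suc m} f = f zero * ∏ (f ∘ suc)

count : ∀ {m} → (Fin m → Bool) → ℕ
count {zero}  p = 0
count {suc m} p = 𝟙 (p zero) + count (p ∘ suc)

∏-cong : ∀ {m} {f g : Fin m → ℕ} → f ≗ g → ∏ f ≡ ∏ g
∏-cong {zero}  f≗g = refl
∏-cong {suc m} f≗g = cong₂ _*_ (f≗g zero) (∏-cong (f≗g ∘ suc))

𝟙-and-tabulate : ∀ {m} (f : Fin m → Bool) → 𝟙 (and (tabulate f)) ≡ ∏ (𝟙 ∘ f)
𝟙-and-tabulate {zero}  f = refl
𝟙-and-tabulate {suc m} f with f zero
... | true  = trans (𝟙-and-tabulate (f ∘ suc)) (sym (ℕₚ.+-identityʳ _))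
... | false = refl

length-filter-tabulate≡count : ∀ {m a} (g : Fin m → Fin a) (p : Fin a → Bool) →
  length (filter (λ i → p i ≟ true) (List.tabulate g)) ≡ count (p ∘ g)
length-filter-tabulate≡count {zero}  g p = refl
length-filter-tabulate≡count {suc m} g p with p (g zero)
... | true  = cong suc (length-filter-tabulate≡count (g ∘ suc) p)
... | false = length-filter-tabulate≡count (g ∘ suc) p

countF≡count : ∀ {m} (p : Fin m → Bool) → countF p ≡ count p
countF≡count = length-filter-tabulate≡count (λ i → i)

length-filter≡sum-𝟙 : ∀ {A : Set} {P : A → Set} P? (xs : List A) →
  length (filter {P = P} P? xs) ≡ sum (map (𝟙 ∘ does ∘ P?) xs)
length-filter≡sum-𝟙 P? []       = refl
length-filter≡sum-𝟙 P? (x ∷ xs) with does (P? x)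
... | true  = cong suc (length-filter≡sum-𝟙 P? xs)
... | false = length-filter≡sum-𝟙 P? xs

T-not : ∀ {x} → T (not x) ⇔ (¬ T x)
T-not {false} = mk⇔ (λ _ ()) (λ _ → tt)
T-not {true}  = mk⇔ (λ ()) (λ ¬t → ¬t tt)

T-and-tabulate : ∀ {n} (f : Fin n → Bool) → T (and (tabulate f)) ⇔ (∀ j → T (f j))
T-and-tabulate {zero}  f = mk⇔ (λ _ ()) (λ _ → tt)
T-and-tabulate {suc n} f = mk⇔
  (λ t → λ { zero → proj₁ (to T-∧ t) ; (suc j) → to (T-and-tabulate (f ∘ suc)) (proj₂ (to T-∧ t)) j })
  (λ h → from T-∧ (h zero , from (T-and-tabulate (f ∘ suc)) (h ∘ suc)))

∈⇔T-lookup : ∀ {N} {I : Subset N} {x} → x ∈ I ⇔ T (lookup I x)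
∈⇔T-lookup {I = I} {x} = mk⇔
  (λ x∈I → subst T (sym (Vecₚ.[]=⇒lookup x∈I)) tt)
  (λ t → Vecₚ.lookup⇒[]= x I (to T-≡ t))

∪⊆⇔ : ∀ {N} {p q r : Subset N} → p ∪ q ⊆ r ⇔ (p ⊆ r × q ⊆ r)
∪⊆⇔ {p = p} {q} {r} = mk⇔ split join
  where
  split : p ∪ q ⊆ r → p ⊆ r × q ⊆ r
  split p∪q⊆r = p∪q⊆r ∘ p⊆p∪q q , p∪q⊆r ∘ q⊆p∪q p q
  join : p ⊆ r × q ⊆ r → p ∪ q ⊆ r
  join (p⊆r , q⊆r) = [ p⊆r , q⊆r ] ∘ x∈p∪q⁻ p q

⋃⊆⇔ : ∀ {N} (ps : List (Subset N)) {r} → ⋃ ps ⊆ r ⇔ All (_⊆ r) ps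
⋃⊆⇔ []   {r} = mk⇔ (λ _ → []) (λ _ {_} → ⊆-min r)
⋃⊆⇔ (p ∷ ps) = ⇔.trans ∪⊆⇔ (mk⇔ (λ (p⊆r , ps⊆r) → p⊆r ∷ to (⋃⊆⇔ ps) ps⊆r)
                                    (map₂ (from (⋃⊆⇔ ps)) ∘ All.uncons))

singletons⊆⇔ : ∀ {N b} (f : Fin b → Fin N) {I : Subset N} →
  All (_⊆ I) (map (λ j → ⁅ f j ⁆) (allFinL b)) ⇔ T (and (tabulate (λ j → lookup I (f j))))
singletons⊆⇔ f {I} = mk⇔
  (λ all⊆ → from (T-and-tabulate _) λ j →
     to ∈⇔T-lookup (Allₚ.tabulate⁻ (Allₚ.map⁻ all⊆) j (x∈⁅x⁆ (f j))))
  (λ t → Allₚ.map⁺ (Allₚ.tabulate⁺ λ j {_} x∈ →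
     subst (_∈ I) (sym (x∈⁅y⁆⇒x≡y (f j) x∈)) (from ∈⇔T-lookup (to (T-and-tabulate _) t j))))

All-++⇔ : ∀ {A : Set} {P : A → Set} (xs : List A) {ys} → All P (xs List.++ ys) ⇔ (All P xs × All P ys)
All-++⇔ xs = ⇔.sym (↔⇒⇔ (Allₚ.++↔ {xs = xs}))

∑ᵛ : ∀ {N} → (Vec Bool N → ℕ) → ℕ
∑ᵛ {zero}  f = f []
∑ᵛ {suc N} f = ∑ᵛ (f ∘ (true ∷_)) + ∑ᵛ (f ∘ (false ∷_))

∑ᵛ-cong : ∀ {N} {f g : Vec Bool N → ℕ} → f ≗ g → ∑ᵛ f ≡ ∑ᵛ g
∑ᵛ-cong {zero}  f≗g = f≗g []
∑ᵛ-cong {suc N} f≗g = cong₂ _+_ (∑ᵛ-cong (f≗g ∘ (true ∷_))) (∑ᵛ-cong (f≗g ∘ (false ∷_)))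

∑ᵛ-*ˡ : ∀ {N} a (f : Vec Bool N → ℕ) → ∑ᵛ (λ x → a * f x) ≡ a * ∑ᵛ f
∑ᵛ-*ˡ {zero}  a f = refl
∑ᵛ-*ˡ {suc N} a f =
  trans (cong₂ _+_ (∑ᵛ-*ˡ a (f ∘ (true ∷_))) (∑ᵛ-*ˡ a (f ∘ (false ∷_))))
        (sym (ℕₚ.*-distribˡ-+ a _ _))

∑ᵛ-*ʳ : ∀ {N} a (f : Vec Bool N → ℕ) → ∑ᵛ (λ x → f x * a) ≡ ∑ᵛ f * a
∑ᵛ-*ʳ a f = begin
  ∑ᵛ (λ x → f x * a)  ≡⟨ ∑ᵛ-cong (λ x → ℕₚ.*-comm (f x) a) ⟩
  ∑ᵛ (λ x → a * f x)  ≡⟨ ∑ᵛ-*ˡ a f ⟩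
  a * ∑ᵛ f            ≡⟨ ℕₚ.*-comm a _ ⟩
  ∑ᵛ f * a            ∎
  where open ≡-Reasoning

∑ᵛ-const : ∀ N a → ∑ᵛ {N} (λ _ → a) ≡ 2 ^ N * a
∑ᵛ-const zero    a = sym (ℕₚ.+-identityʳ a)
∑ᵛ-const (suc N) a = begin
  ∑ᵛ {N} (λ _ → a) + ∑ᵛ {N} (λ _ → a)  ≡⟨ cong₂ _+_ (∑ᵛ-const N a) (∑ᵛ-const N a) ⟩
  2 ^ N * a + 2 ^ N * a                ≡⟨ double (2 ^ N) a ⟩
  2 * 2 ^ N * a                        ∎
  where
  open ≡-Reasoning
  double : ∀ x a → x * a + x * a ≡ 2 * x * a
  double = solve-∀

∑ᵛ-++ : ∀ p q (f : Vec Bool (p + q) → ℕ) → ∑ᵛ f ≡ ∑ᵛ {p} (λ x → ∑ᵛ {q} (λ y → f (x ++ y)))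
∑ᵛ-++ zero    q f = refl
∑ᵛ-++ (suc p) q f = cong₂ _+_ (∑ᵛ-++ p q (f ∘ (true ∷_))) (∑ᵛ-++ p q (f ∘ (false ∷_)))

sum-allVecs : ∀ N (f : Vec Bool N → ℕ) → sum (map f (allVecs N)) ≡ ∑ᵛ f
sum-allVecs zero    f = ℕₚ.+-identityʳ (f [])
sum-allVecs (suc N) f = begin
  sum (map f (map (true ∷_) A List.++ map (false ∷_) A))
    ≡⟨ cong sum (Listₚ.map-++ f (map (true ∷_) A) _) ⟩
  sum (map f (map (true ∷_) A) List.++ map f (map (false ∷_) A))
    ≡⟨ sum-++ (map f (map (true ∷_) A)) _ ⟩
  sum (map f (map (true ∷_) A)) + sum (map f (map (false ∷_) A))
    ≡⟨ cong₂ _+_ (cong sum (sym (Listₚ.map-∘ A))) (cong sum (sym (Listₚ.map-∘ A))) ⟩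
  sum (map (f ∘ (true ∷_)) A) + sum (map (f ∘ (false ∷_)) A)
    ≡⟨ cong₂ _+_ (sum-allVecs N _) (sum-allVecs N _) ⟩
  ∑ᵛ f ∎
  where
  open ≡-Reasoning
  A = allVecs N

[p∸1]x+px≡[2p∸1]x : ∀ p x → 0 < p → (p ∸ 1) * x + p * x ≡ (2 * p ∸ 1) * x
[p∸1]x+px≡[2p∸1]x (suc q) x _ = identity q x
  where
  identity : ∀ q x → q * x + suc q * x ≡ (q + (suc q + 0)) * x
  identity = solve-∀

∑ᵛ-and : ∀ b (φ : Bool → ℕ) → ∑ᵛ {b} (φ ∘ and) ≡ φ true + (2 ^ b ∸ 1) * φ false
∑ᵛ-and zero    φ = sym (ℕₚ.+-identityʳ (φ true))
∑ᵛ-and (suc b) φ = begin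
  ∑ᵛ {b} (φ ∘ and) + ∑ᵛ {b} (λ _ → φ false)
    ≡⟨ cong₂ _+_ (∑ᵛ-and b φ) (∑ᵛ-const b (φ false)) ⟩
  φ true + (2 ^ b ∸ 1) * φ false + 2 ^ b * φ false
    ≡⟨ ℕₚ.+-assoc (φ true) _ _ ⟩
  φ true + ((2 ^ b ∸ 1) * φ false + 2 ^ b * φ false)
    ≡⟨ cong (φ true +_) ([p∸1]x+px≡[2p∸1]x (2 ^ b) (φ false) (ℕₚ.m^n>0 2 b)) ⟩
  φ true + (2 ^ suc b ∸ 1) * φ false ∎
  where open ≡-Reasoning

block : ∀ {p c} → Fin p → Vec Bool (p * c) → Vec Bool c
block e Y = tabulate (λ j → lookup Y (combine e j))

block-++-zero : ∀ {p c} (y : Vec Bool c) (Y : Vec Bool (p * c)) → block {suc p} zero (y ++ Y) ≡ y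
block-++-zero y Y = trans (Vecₚ.tabulate-cong (Vecₚ.lookup-++ˡ y Y)) (Vecₚ.tabulate∘lookup y)

block-++-suc : ∀ {p c} (y : Vec Bool c) (Y : Vec Bool (p * c)) e →
  block {suc p} (suc e) (y ++ Y) ≡ block e Y
block-++-suc y Y e = Vecₚ.tabulate-cong (λ j → Vecₚ.lookup-++ʳ y Y (combine e j))

∑ᵛ-∏-block : ∀ m c (h : Fin m → Vec Bool c → ℕ) →
  ∑ᵛ {m * c} (λ Y → ∏ (λ e → h e (block e Y))) ≡ ∏ (λ e → ∑ᵛ (h e))
∑ᵛ-∏-block zero    c h = refl
∑ᵛ-∏-block (suc m) c h = begin
  ∑ᵛ {c + m * c} (λ Y → ∏ (λ e → h e (block e Y)))
    ≡⟨ ∑ᵛ-++ c (m * c) _ ⟩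
  ∑ᵛ {c} (λ y → ∑ᵛ {m * c} (λ Y →
    h zero (block {suc m} zero (y ++ Y)) * ∏ (λ e → h (suc e) (block {suc m} (suc e) (y ++ Y)))))
    ≡⟨ ∑ᵛ-cong (λ y → ∑ᵛ-cong (λ Y → cong₂ _*_ (cong (h zero) (block-++-zero {m} y Y))
                                               (∏-cong (λ e → cong (h (suc e)) (block-++-suc {m} y Y e))))) ⟩
  ∑ᵛ {c} (λ y → ∑ᵛ (λ Y → h zero y * rest Y))
    ≡⟨ ∑ᵛ-cong (λ y → ∑ᵛ-*ˡ (h zero y) rest) ⟩
  ∑ᵛ {c} (λ y → h zero y * ∑ᵛ rest)
    ≡⟨ ∑ᵛ-*ʳ (∑ᵛ rest) (h zero) ⟩
  ∑ᵛ (h zero) * ∑ᵛ rest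
    ≡⟨ cong (∑ᵛ (h zero) *_) (∑ᵛ-∏-block m c (h ∘ suc)) ⟩
  ∏ (λ e → ∑ᵛ (h e)) ∎
  where
  open ≡-Reasoning
  rest : Vec Bool (m * c) → ℕ
  rest Y = ∏ (λ e → h (suc e) (block e Y))

spinsOf : ∀ {n} b → Vec Bool (n * b) → Vec Bool n
spinsOf b X = tabulate (λ v → and (block v X))

spinsOf-++ : ∀ {n b} (x : Vec Bool b) (X : Vec Bool (n * b)) →
  spinsOf {suc n} b (x ++ X) ≡ and x ∷ spinsOf b X
spinsOf-++ {n} x X = cong₂ _∷_ (cong and (block-++-zero {n} x X))
                               (Vecₚ.tabulate-cong (cong and ∘ block-++-suc {n} x X))

vertexWeight : ∀ {n} → ℕ → Vec Bool n → ℕ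
vertexWeight b σ = ∏ (λ v → if not (lookup σ v) then 2 ^ b ∸ 1 else 1)

∑ᵛ-spinsOf : ∀ n b (F : Vec Bool n → ℕ) →
  ∑ᵛ {n * b} (F ∘ spinsOf b) ≡ ∑ᵛ (λ σ → vertexWeight b σ * F σ)
∑ᵛ-spinsOf zero    b F = sym (ℕₚ.+-identityʳ (F []))
∑ᵛ-spinsOf (suc n) b F = begin
  ∑ᵛ {b + n * b} (F ∘ spinsOf b)
    ≡⟨ ∑ᵛ-++ b (n * b) _ ⟩
  ∑ᵛ {b} (λ x → ∑ᵛ {n * b} (λ X → F (spinsOf b (x ++ X))))
    ≡⟨ ∑ᵛ-cong (λ x → ∑ᵛ-cong (λ X → cong F (spinsOf-++ {n} {b} x X))) ⟩
  ∑ᵛ {b} (withFirstSpin ∘ and)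
    ≡⟨ ∑ᵛ-and b withFirstSpin ⟩
  withFirstSpin true + (2 ^ b ∸ 1) * withFirstSpin false
    ≡⟨ cong₂ (λ s t → s + (2 ^ b ∸ 1) * t) (∑ᵛ-spinsOf n b _) (∑ᵛ-spinsOf n b _) ⟩
  ∑ᵛ (λ σ → w σ * F (true ∷ σ)) + (2 ^ b ∸ 1) * ∑ᵛ (λ σ → w σ * F (false ∷ σ))
    ≡⟨ cong₂ _+_ (∑ᵛ-cong (λ σ → cong (_* F (true ∷ σ)) (sym (ℕₚ.*-identityˡ (w σ)))))
                 (sym (trans (∑ᵛ-cong (λ σ → ℕₚ.*-assoc (2 ^ b ∸ 1) (w σ) _))
                             (∑ᵛ-*ˡ (2 ^ b ∸ 1) (λ σ → w σ * F (false ∷ σ))))) ⟩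
  ∑ᵛ (λ σ → vertexWeight b σ * F σ) ∎
  where
  open ≡-Reasoning
  w = vertexWeight b
  withFirstSpin : Bool → ℕ
  withFirstSpin β = ∑ᵛ {n * b} (λ X → F (β ∷ spinsOf b X))

edgeWeight : ℕ → Bool → ℕ
edgeWeight c a = if a then 2 ^ c ∸ 1 else 2 ^ c

∑ᵛ-not-∧-and : ∀ c a → ∑ᵛ {c} (λ y → 𝟙 (not (a ∧ and y))) ≡ edgeWeight c a
∑ᵛ-not-∧-and c a = trans (∑ᵛ-and c (λ β → 𝟙 (not (a ∧ β)))) (by-cases a)
  where
  by-cases : ∀ a → 𝟙 (not (a ∧ true)) + (2 ^ c ∸ 1) * 𝟙 (not (a ∧ false)) ≡ edgeWeight c a
  by-cases true  = ℕₚ.*-identityʳ (2 ^ c ∸ 1)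
  by-cases false = trans (cong (1 +_) (ℕₚ.*-identityʳ (2 ^ c ∸ 1))) (ℕₚ.m+[n∸m]≡n (ℕₚ.m^n>0 2 c))

ℕtoℚ≡mkℚ : ∀ k → ℕtoℚ k ≡ mkℚ (ℤ.+ k) 0 (Coprime.sym (1-coprimeTo k))
ℕtoℚ≡mkℚ k = ℚₚ.normalize-coprime (Coprime.sym (1-coprimeTo k))

ℕtoℚ-homo-+ : ∀ x y → ℕtoℚ (x + y) ≡ ℕtoℚ x ℚ.+ ℕtoℚ y
ℕtoℚ-homo-+ x y rewrite ℕtoℚ≡mkℚ x | ℕtoℚ≡mkℚ y =
  sym (ℚₚ./-cong (trans (cong₂ ℤ._+_ (ℤₚ.*-identityʳ (ℤ.+ x)) (ℤₚ.*-identityʳ (ℤ.+ y)))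
                        (sym (ℤₚ.pos-+ x y)))
                 refl)

ℕtoℚ-homo-* : ∀ x y → ℕtoℚ (x * y) ≡ ℕtoℚ x ℚ.* ℕtoℚ y
ℕtoℚ-homo-* x y rewrite ℕtoℚ≡mkℚ x | ℕtoℚ≡mkℚ y = sym (ℚₚ./-cong (sym (ℤₚ.pos-* x y)) refl)

ℕtoℚ-sum : ∀ {A : Set} (f : A → ℕ) xs → ℕtoℚ (sum (map f xs)) ≡ sumℚ (map (ℕtoℚ ∘ f) xs)
ℕtoℚ-sum f []       = refl
ℕtoℚ-sum f (x ∷ xs) = trans (ℕtoℚ-homo-+ (f x) _) (cong (ℕtoℚ (f x) ℚ.+_) (ℕtoℚ-sum f xs))

ℕtoℚ-*-inverse : ∀ x .{{_ : ℕ.NonZero x}} → ℕtoℚ x ℚ.* (ℤ.+ 1 / x) ≡ 1ℚ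
ℕtoℚ-*-inverse (suc y)
  rewrite ℕtoℚ≡mkℚ (suc y) | ℚₚ.normalize-coprime {1} {y} (1-coprimeTo (suc y)) =
  ℚₚ.*-inverseʳ (mkℚ (ℤ.+ suc y) 0 (Coprime.sym (1-coprimeTo (suc y))))

ℕtoℚ-∸1 : ∀ x .{{_ : ℕ.NonZero x}} → ℕtoℚ (x ∸ 1) ≡ ℕtoℚ x ℚ.* (1ℚ ℚ.- ℤ.+ 1 / x)
ℕtoℚ-∸1 x@(suc y) = begin
  ℕtoℚ y                                       ≡⟨ lemma (ℕtoℚ y) ⟩
  (1ℚ ℚ.+ ℕtoℚ y) ℚ.- 1ℚ                         ≡⟨ cong₂ ℚ._-_ (sym (ℕtoℚ-homo-+ 1 y)) (sym (ℕtoℚ-*-inverse x)) ⟩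
  ℕtoℚ x ℚ.- ℕtoℚ x ℚ.* (ℤ.+ 1 / x)             ≡⟨ distrib (ℕtoℚ x) (ℤ.+ 1 / x) ⟩
  ℕtoℚ x ℚ.* (1ℚ ℚ.- ℤ.+ 1 / x)                 ∎
  where
  open ≡-Reasoning
  open +-*-Solver
  lemma : ∀ z → z ≡ (1ℚ ℚ.+ z) ℚ.- 1ℚ
  lemma = solve 1 (λ z → z := (con 1ℚ :+ z) :- con 1ℚ) refl
  distrib : ∀ p q → p ℚ.- p ℚ.* q ≡ p ℚ.* (1ℚ ℚ.- q)
  distrib = solve 2 (λ p q → p :- p :* q := p :* (con 1ℚ :- q)) refl

sumℚ-*ˡ : ∀ {A : Set} (K : ℚ) (φ : A → ℚ) xs → sumℚ (map (λ x → K ℚ.* φ x) xs) ≡ K ℚ.* sumℚ (map φ xs)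
sumℚ-*ˡ K φ []       = sym (ℚₚ.*-zeroʳ K)
sumℚ-*ˡ K φ (x ∷ xs) = trans (cong (K ℚ.* φ x ℚ.+_) (sumℚ-*ˡ K φ xs)) (sym (ℚₚ.*-distribˡ-+ K (φ x) _))

ℕtoℚ-∏-if : ∀ {m} (a : Fin m → Bool) {w₁ w₀ : ℕ} {g : ℚ} → ℕtoℚ w₁ ≡ ℕtoℚ w₀ ℚ.* g →
  ℕtoℚ (∏ (λ i → if a i then w₁ else w₀)) ≡ ℕtoℚ (w₀ ^ m) ℚ.* g ^ℚ count a
ℕtoℚ-∏-if {zero}  a _ = sym (ℚₚ.*-identityʳ _)
ℕtoℚ-∏-if {suc m} a {w₁} {w₀} {g} w₁≡w₀g with a zero
... | true  = begin
  ℕtoℚ (w₁ * P)                                  ≡⟨ ℕtoℚ-homo-* w₁ P ⟩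
  ℕtoℚ w₁ ℚ.* ℕtoℚ P                              ≡⟨ cong₂ ℚ._*_ w₁≡w₀g IH ⟩
  (ℕtoℚ w₀ ℚ.* g) ℚ.* (ℕtoℚ (w₀ ^ m) ℚ.* gᵏ)       ≡⟨ interchange (ℕtoℚ w₀) g (ℕtoℚ (w₀ ^ m)) gᵏ ⟩
  (ℕtoℚ w₀ ℚ.* ℕtoℚ (w₀ ^ m)) ℚ.* (g ℚ.* gᵏ)      ≡⟨ cong (ℚ._* (g ℚ.* gᵏ)) (sym (ℕtoℚ-homo-* w₀ (w₀ ^ m))) ⟩
  ℕtoℚ (w₀ ^ suc m) ℚ.* (g ℚ.* gᵏ)                ∎
  where
  open ≡-Reasoning
  P  = ∏ (λ i → if a (suc i) then w₁ else w₀)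
  gᵏ = g ^ℚ count (a ∘ suc)
  IH = ℕtoℚ-∏-if (a ∘ suc) w₁≡w₀g
  interchange : ∀ p q r s → (p ℚ.* q) ℚ.* (r ℚ.* s) ≡ (p ℚ.* r) ℚ.* (q ℚ.* s)
  interchange = solve 4 (λ p q r s → (p :* q) :* (r :* s) := (p :* r) :* (q :* s)) refl
    where open +-*-Solver
... | false = begin
  ℕtoℚ (w₀ * P)                                  ≡⟨ ℕtoℚ-homo-* w₀ P ⟩
  ℕtoℚ w₀ ℚ.* ℕtoℚ P                              ≡⟨ cong (ℕtoℚ w₀ ℚ.*_) (ℕtoℚ-∏-if (a ∘ suc) w₁≡w₀g) ⟩
  ℕtoℚ w₀ ℚ.* (ℕtoℚ (w₀ ^ m) ℚ.* gᵏ)              ≡⟨ ℚₚ.*-assoc (ℕtoℚ w₀) _ gᵏ ⟨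
  (ℕtoℚ w₀ ℚ.* ℕtoℚ (w₀ ^ m)) ℚ.* gᵏ              ≡⟨ cong (ℚ._* gᵏ) (sym (ℕtoℚ-homo-* w₀ (w₀ ^ m))) ⟩
  ℕtoℚ (w₀ ^ suc m) ℚ.* gᵏ                        ∎
  where
  open ≡-Reasoning
  P  = ∏ (λ i → if a (suc i) then w₁ else w₀)
  gᵏ = g ^ℚ count (a ∘ suc)

1ℚ^ℚ : ∀ k → 1ℚ ^ℚ k ≡ 1ℚ
1ℚ^ℚ zero    = refl
1ℚ^ℚ (suc k) = trans (ℚₚ.*-identityˡ _) (1ℚ^ℚ k)

ℕtoℚ-vertexWeight : ∀ {n} b (σ : Vec Bool n) →
  ℕtoℚ (vertexWeight b σ) ≡ ℕtoℚ (2 ^ b ∸ 1) ^ℚ countF (λ v → not (lookup σ v))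
ℕtoℚ-vertexWeight {n} b σ = begin
  ℕtoℚ (vertexWeight b σ)                   ≡⟨ ℕtoℚ-∏-if (not ∘ lookup σ) (sym (ℚₚ.*-identityˡ _)) ⟩
  ℕtoℚ (1 ^ n) ℚ.* Λ ^ℚ count (not ∘ lookup σ)  ≡⟨ cong₂ (λ x y → ℕtoℚ x ℚ.* Λ ^ℚ y) (ℕₚ.^-zeroˡ n)
                                                         (sym (countF≡count (not ∘ lookup σ))) ⟩
  1ℚ ℚ.* Λ ^ℚ countF (not ∘ lookup σ)          ≡⟨ ℚₚ.*-identityˡ _ ⟩
  Λ ^ℚ countF (not ∘ lookup σ)                 ∎
  where
  open ≡-Reasoning
  Λ = ℕtoℚ (2 ^ b ∸ 1)

ℕtoℚ-∏-edgeWeight : ∀ {m} c (a : Fin m → Bool) →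
  ℕtoℚ (∏ (edgeWeight c ∘ a)) ≡ ℕtoℚ (2 ^ (m * c)) ℚ.* gammaOf c ^ℚ countF a
ℕtoℚ-∏-edgeWeight {m} c a = begin
  ℕtoℚ (∏ (edgeWeight c ∘ a))                  ≡⟨ ℕtoℚ-∏-if a (ℕtoℚ-∸1 (2 ^ c) {{ℕₚ.m^n≢0 2 c}}) ⟩
  ℕtoℚ ((2 ^ c) ^ m) ℚ.* gammaOf c ^ℚ count a   ≡⟨ cong₂ (λ x y → ℕtoℚ x ℚ.* gammaOf c ^ℚ y)
                                                         (trans (ℕₚ.^-*-assoc 2 c m) (cong (2 ^_) (ℕₚ.*-comm c m)))
                                                         (sym (countF≡count a)) ⟩
  ℕtoℚ (2 ^ (m * c)) ℚ.* gammaOf c ^ℚ countF a  ∎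
  where open ≡-Reasoning

module _ (G : Graph) (k b : ℕ) where

  private
    c = k ∸ 2 * b
    H = HG G k b
    u v : Fin (m G) → Fin (n G)
    u e = proj₁ (ends G e)
    v e = proj₂ (ends G e)
    Λ = ℕtoℚ (2 ^ b ∸ 1)

  filled : Subset (N H) → Fin (m G) → Bool
  filled I e = and (tabulate (λ j → lookup I (Bvert G b c (u e) j)))
             ∧ and (tabulate (λ j → lookup I (Bvert G b c (v e) j)))
             ∧ and (tabulate (λ j → lookup I (Cvert G b c e j)))

  hedge⊆⇔filled : ∀ e {I} → hedge H e ⊆ I ⇔ T (filled I e)
  hedge⊆⇔filled e = ⇔.trans (⋃⊆⇔ _) (⇔.trans (All-++⇔ _)
    (⇔.trans (singletons⊆⇔ (Bvert G b c (u e)) ×-⇔ ⇔.trans (All-++⇔ _)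
                 (singletons⊆⇔ (Bvert G b c (v e)) ×-⇔ singletons⊆⇔ (Cvert G b c e)))
             (⇔.sym (⇔.trans T-∧ (⇔.refl ×-⇔ T-∧)))))

  isIndependent⇔ : ∀ I → IsIndependent H I ⇔ T (and (tabulate (λ e → not (filled I e))))
  isIndependent⇔ I = mk⇔
    (λ indep → from (T-and-tabulate _) (λ e → from T-not (indep e ∘ from (hedge⊆⇔filled e))))
    (λ t e → to T-not (to (T-and-tabulate _) t e) ∘ to (hedge⊆⇔filled e))

  𝟙-isIndependent : ∀ I → 𝟙 (does (isIndependent? H I)) ≡ ∏ (λ e → 𝟙 (not (filled I e)))
  𝟙-isIndependent I = trans (cong 𝟙 (does-⇔ (isIndependent⇔ I) (isIndependent? H I) (T? _)))
                            (𝟙-and-tabulate (λ e → not (filled I e)))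

  filled-++ : ∀ X Y e → let σ = spinsOf b X in
    filled (X ++ Y) e ≡ (lookup σ (u e) ∧ lookup σ (v e)) ∧ and (block {m G} {c} e Y)
  filled-++ X Y e =
    trans (cong₂ _∧_ (B-spin (u e)) (cong₂ _∧_ (B-spin (v e)) C-block)) (sym (∧-assoc (lookup σ (u e)) (lookup σ (v e)) (and (block e Y))))
    where
    σ = spinsOf b X
    B-spin : ∀ w → and (tabulate (λ j → lookup (X ++ Y) (Bvert G b c w j)))
                 ≡ lookup (spinsOf b X) w
    B-spin w = trans (cong and (Vecₚ.tabulate-cong (λ j → Vecₚ.lookup-++ˡ X Y (combine w j))))
                     (sym (Vecₚ.lookup∘tabulate _ w))
    C-block : and (tabulate (λ j → lookup (X ++ Y) (Cvert G b c e j))) ≡ and (block e Y)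
    C-block = cong and (Vecₚ.tabulate-cong (λ j → Vecₚ.lookup-++ʳ X Y (combine e j)))

  bothSpin1 : Vec Bool (n G) → Fin (m G) → Bool
  bothSpin1 σ e = lookup σ (u e) ∧ lookup σ (v e)

  configurationWeight : Vec Bool (n G) → ℕ
  configurationWeight σ = vertexWeight b σ * ∏ (edgeWeight c ∘ bothSpin1 σ)

  numIndep-HG : numIndep H ≡ ∑ᵛ configurationWeight
  numIndep-HG = begin
    numIndep H
      ≡⟨ length-filter≡sum-𝟙 (isIndependent? H) (allVecs (N H)) ⟩
    sum (map (𝟙 ∘ does ∘ isIndependent? H) (allVecs (N H)))
      ≡⟨ sum-allVecs (N H) _ ⟩
    ∑ᵛ (𝟙 ∘ does ∘ isIndependent? H)
      ≡⟨ ∑ᵛ-++ (n G * b) (m G * c) _ ⟩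
    ∑ᵛ {n G * b} (λ X → ∑ᵛ {m G * c} (λ Y → 𝟙 (does (isIndependent? H (X ++ Y)))))
      ≡⟨ ∑ᵛ-cong (λ X → ∑ᵛ-cong (λ Y → trans (𝟙-isIndependent (X ++ Y))
                                             (∏-cong (cong (𝟙 ∘ not) ∘ filled-++ X Y)))) ⟩
    ∑ᵛ {n G * b} (λ X → ∑ᵛ (λ Y → ∏ (λ e → 𝟙 (not (bothSpin1 (spinsOf b X) e ∧ and (block e Y))))))
      ≡⟨ ∑ᵛ-cong (λ X → ∑ᵛ-∏-block (m G) c (λ e y → 𝟙 (not (bothSpin1 (spinsOf b X) e ∧ and y)))) ⟩
    ∑ᵛ {n G * b} (λ X → ∏ (λ e → ∑ᵛ {c} (λ y → 𝟙 (not (bothSpin1 (spinsOf b X) e ∧ and y)))))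
      ≡⟨ ∑ᵛ-cong (λ X → ∏-cong (∑ᵛ-not-∧-and c ∘ bothSpin1 (spinsOf b X))) ⟩
    ∑ᵛ {n G * b} (λ X → ∏ (edgeWeight c ∘ bothSpin1 (spinsOf b X)))
      ≡⟨ ∑ᵛ-spinsOf (n G) b (λ σ → ∏ (edgeWeight c ∘ bothSpin1 σ)) ⟩
    ∑ᵛ configurationWeight ∎
    where open ≡-Reasoning

  ℕtoℚ-configurationWeight : ∀ σ → ℕtoℚ (configurationWeight σ) ≡
    ℕtoℚ (2 ^ (m G * c)) ℚ.* (Λ ^ℚ n0 G σ ℚ.* 1ℚ ^ℚ m00 G σ ℚ.* gammaOf c ^ℚ m11 G σ)
  ℕtoℚ-configurationWeight σ = begin
    ℕtoℚ (vertexWeight b σ * ∏ (edgeWeight c ∘ bothSpin1 σ))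
      ≡⟨ ℕtoℚ-homo-* (vertexWeight b σ) _ ⟩
    ℕtoℚ (vertexWeight b σ) ℚ.* ℕtoℚ (∏ (edgeWeight c ∘ bothSpin1 σ))
      ≡⟨ cong₂ ℚ._*_ (ℕtoℚ-vertexWeight b σ) (ℕtoℚ-∏-edgeWeight c (bothSpin1 σ)) ⟩
    Λ ^ℚ n0 G σ ℚ.* (K ℚ.* γᵐ)
      ≡⟨ rearrange (Λ ^ℚ n0 G σ) K γᵐ ⟩
    K ℚ.* (Λ ^ℚ n0 G σ ℚ.* 1ℚ ℚ.* γᵐ)
      ≡⟨ cong (λ x → K ℚ.* (Λ ^ℚ n0 G σ ℚ.* x ℚ.* γᵐ)) (sym (1ℚ^ℚ (m00 G σ))) ⟩
    K ℚ.* (Λ ^ℚ n0 G σ ℚ.* 1ℚ ^ℚ m00 G σ ℚ.* γᵐ) ∎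
    where
    open ≡-Reasoning
    open +-*-Solver
    K  = ℕtoℚ (2 ^ (m G * c))
    γᵐ = gammaOf c ^ℚ m11 G σ
    rearrange : ∀ x y z → x ℚ.* (y ℚ.* z) ≡ y ℚ.* (x ℚ.* 1ℚ ℚ.* z)
    rearrange = solve 3 (λ x y z → x :* (y :* z) := y :* (x :* con 1ℚ :* z)) refl

-- The identity holds for every graph and all k, b.
lemma2 : (k b Δ : ℕ) → 2 ≤ k → 1 ≤ b → 2 * b ≤ k → 1 ≤ Δ →
    (G : Graph) → Regular Δ G →
    ℕtoℚ (numIndep (HG G k b))
      ≡ ℕtoℚ (2 ^ (m G * (k ∸ 2 * b)))
        Data.Rational.* Z G (ℕtoℚ (2 ^ b ∸ 1)) 1ℚ (gammaOf (k ∸ 2 * b))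
lemma2 k b _ _ _ _ _ G _ = begin
  ℕtoℚ (numIndep (HG G k b))
    ≡⟨ cong ℕtoℚ (trans (numIndep-HG G k b) (sym (sum-allVecs (n G) weight))) ⟩
  ℕtoℚ (sum (map weight σs))
    ≡⟨ ℕtoℚ-sum weight σs ⟩
  sumℚ (map (ℕtoℚ ∘ weight) σs)
    ≡⟨ cong sumℚ (Listₚ.map-cong (ℕtoℚ-configurationWeight G k b) σs) ⟩
  sumℚ (map (λ σ → K ℚ.* summand σ) σs)
    ≡⟨ sumℚ-*ˡ K summand σs ⟩
  K ℚ.* Z G (ℕtoℚ (2 ^ b ∸ 1)) 1ℚ (gammaOf (k ∸ 2 * b)) ∎
  where
  open ≡-Reasoning
  σs = allVecs (n G)
  weight = configurationWeight G k b
  K = ℕtoℚ (2 ^ (m G * (k ∸ 2 * b)))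
  summand : Vec Bool (n G) → ℚ
  summand σ = ℕtoℚ (2 ^ b ∸ 1) ^ℚ n0 G σ ℚ.* 1ℚ ^ℚ m00 G σ ℚ.* gammaOf (k ∸ 2 * b) ^ℚ m11 G σ
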